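{- In the edge-distinguishing game (EDGe) played on the path $P_4$ (with $\lambda(P_4)$ colors), Player 1 has a winning strategy.
   Context: $P_n$ is the path on $n$ vertices. For a positive integer $k$ let $[k]=\{1,\dots,k\}$. A $k$-coloring $c:V(G)\to[k]$ induces $c'(\{u,v\})=\{c(u),c(v)\}$ (a multiset); $c$ is edge-distinguishing if $c'$ is injective, and $\lambda(G)$ is the least $k$ admitting such a coloring. A partial coloring on $U\subseteq V(G)$ has partial induced edge coloring on $G[U]$. EDGe on $G$: two players, Player 1 first, alternately color an uncolored vertex with a color from $[\lambda(G)]$; a move is legal iff afterwards the partial induced edge coloring of the colored vertices is injective. The player making the last legal move wins. A winning strategy guarantees a win regardless of the opponent's play. -}

module Defs where

open import Data.Nat using (ℕ; suc; _<_)
open import Data.Fin using (Fin; toℕ; _≟_)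
open import Data.Maybe using (Maybe; just; nothing)
open import Data.Product using (_×_; ∃)
open import Data.Sum using (_⊎_)
open import Relation.Nullary using (¬_; yes; no)
open import Relation.Binary.PropositionalEquality using (_≡_)

-- A (simple, finite) graph on vertex set Fin n, given by its adjacency relation.
-- An edge is an unordered pair {u,v} with Adj u v.
record Graph (n : ℕ) : Set₁ where
  field
    Adj : Fin n → Fin n → Set

open Graph public

SameMS : {A : Set} → A → A → A → A → Set
SameMS a b x y = (a ≡ x × b ≡ y) ⊎ (a ≡ y × b ≡ x)

Path : (n : ℕ) → Graph n
Path n = record { Adj = λ i j → (toℕ j ≡ suc (toℕ i)) ⊎ (toℕ i ≡ suc (toℕ j)) }

EdgeDistinguishing : ∀ {n} (G : Graph n) (k : ℕ) → (Fin n → Fin k) → Set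
EdgeDistinguishing G k c =
  ∀ u v x y → Adj G u v → Adj G x y →
    SameMS (c u) (c v) (c x) (c y) → SameMS u v x y

IsLambda : ∀ {n} (G : Graph n) (k : ℕ) → Set
IsLambda {n} G k =
  ∃ (λ (c : Fin n → Fin k) → EdgeDistinguishing G k c) ×
  (∀ j → j < k → ¬ ∃ (λ (c : Fin n → Fin j) → EdgeDistinguishing G j c))

-- Partial colourings: nothing = uncoloured.
Partial : ℕ → ℕ → Set
Partial n k = Fin n → Maybe (Fin k)

PartialInjective : ∀ {n k} (G : Graph n) → Partial n k → Set
PartialInjective G p =
  ∀ u v x y a b a' b' → Adj G u v → Adj G x y →
    p u ≡ just a → p v ≡ just b → p x ≡ just a' → p y ≡ just b' →
    SameMS a b a' b' → SameMS u v x y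

update : ∀ {n k} → Partial n k → Fin n → Fin k → Partial n k
update p v col w with w ≟ v
... | yes _ = just col
... | no _  = p w

Legal : ∀ {n k} (G : Graph n) → Partial n k → Fin n → Fin k → Set
Legal G p v col = (p v ≡ nothing) × PartialInjective G (update p v col)

-- Game-tree semantics (normal play: last legal move wins).
mutual
  data MoverWins {n k} (G : Graph n) (p : Partial n k) : Set where
    move : (v : Fin n) (col : Fin k) → Legal G p v col →
           MoverLoses G (update p v col) → MoverWins G p

  data MoverLoses {n k} (G : Graph n) (p : Partial n k) : Set where
    allMoves : (∀ (v : Fin n) (col : Fin k) → Legal G p v col →
                MoverWins G (update p v col)) → MoverLoses G p

empty : ∀ {n k} → Partial n k
empty _ = nothing

Player1Wins : ∀ {n} (G : Graph n) (k : ℕ) → Set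
Player1Wins G k = MoverWins {k = k} G empty

{-# OPTIONS --safe #-}
-- λ(P₄) = 2: one colour gives the two edges at an inner vertex the same
-- multiset, while the colouring 0011 separates all three edges.  With two
-- colours the only edge-distinguishing colourings of P₄ are 0011 and 1100,
-- so a play that colours all four vertices ends on Player 2's move, and
-- Player 1 must instead reach a dead position after an odd number of moves.
-- Opening at an end vertex achieves this; the game tree is small enough to be
-- searched exhaustively, and the search returns the winning strategy itself.
module Submission where

open import Defs
open import Data.Nat using (ℕ; zero; suc; s≤s)
import Data.Nat as ℕ
open import Data.Nat.Properties using (<-cmp)
open import Data.Fin using (Fin; zero; suc; toℕ; _≟_)
open import Data.Fin.Properties using (all?; ¬Fin0)
open import Data.Maybe using (Maybe; just; nothing; from-just; map; _<∣>_; _>>=_)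
open import Data.Maybe.Properties using (≡-dec)
open import Data.Product using (_,_; ∃)
open import Data.Sum using (inj₁; inj₂)
open import Data.Empty using (⊥-elim)
open import Function using (_∘_; const)
open import Relation.Binary using (Decidable; DecidableEquality; tri<; tri≈; tri>)
open import Relation.Nullary using (Dec; yes; no; ¬_)
open import Relation.Nullary.Decidable using (map′; _×-dec_; _⊎-dec_; _→-dec_; dec⇒maybe; from-yes)
open import Relation.Binary.PropositionalEquality using (_≡_; refl; subst)

sameMS? : {A : Set} → DecidableEquality A → (a b x y : A) → Dec (SameMS a b x y)
sameMS? _≟ᴬ_ a b x y = (a ≟ᴬ x ×-dec b ≟ᴬ y) ⊎-dec (a ≟ᴬ y ×-dec b ≟ᴬ x)

whenJust? : {A : Set} {P : A → Set} (m : Maybe A) →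
            (∀ a → Dec (P a)) → Dec (∀ a → m ≡ just a → P a)
whenJust? nothing  P? = yes λ _ ()
whenJust? (just a) P? = map′ (λ { pa _ refl → pa }) (λ f → f a refl) (P? a)

anyJust : ∀ {m} {R : Set} → (Fin m → Maybe R) → Maybe R
anyJust {zero}  f = nothing
anyJust {suc m} f = f zero <∣> anyJust (f ∘ suc)

allJust : ∀ {m} {R : Fin m → Set} → ((i : Fin m) → Maybe (R i)) → Maybe ((i : Fin m) → R i)
allJust {zero}  f = just λ ()
allJust {suc m} f with f zero | allJust (f ∘ suc)
... | just r | just g = just λ { zero → r ; (suc i) → g i }
... | _      | _      = nothing

module GameSearch {n k : ℕ} (G : Graph n) (adj? : Decidable (Adj G)) where

  partialInjective? : (p : Partial n k) → Dec (PartialInjective G p)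
  partialInjective? p =
    map′ (λ h u v x y a b a′ b′ uv xy pa pb pa′ pb′ → h u v x y uv xy a pa b pb a′ pa′ b′ pb′)
         (λ h u v x y uv xy a pa b pb a′ pa′ b′ pb′ → h u v x y a b a′ b′ uv xy pa pb pa′ pb′)
         (all? λ u → all? λ v → all? λ x → all? λ y →
            adj? u v →-dec adj? x y →-dec
            whenJust? (p u) λ a → whenJust? (p v) λ b → whenJust? (p x) λ a′ → whenJust? (p y) λ b′ →
            sameMS? _≟_ a b a′ b′ →-dec sameMS? _≟_ u v x y)

  legal? : (p : Partial n k) (v : Fin n) (col : Fin k) → Dec (Legal G p v col)
  legal? p v col = ≡-dec _≟_ (p v) nothing ×-dec partialInjective? (update p v col)

  -- Sound but incomplete: `nothing` only means that the fuel, a bound on the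
  -- number of moves of the player to move, ran out.
  mutual
    searchWin : ℕ → (p : Partial n k) → Maybe (MoverWins G p)
    searchWin zero       p = nothing
    searchWin (suc fuel) p = anyJust λ v → anyJust λ col →
      dec⇒maybe (legal? p v col) >>= λ l → map (move v col l) (searchLoss fuel (update p v col))

    searchLoss : ℕ → (p : Partial n k) → Maybe (MoverLoses G p)
    searchLoss fuel p = map allMoves (allJust λ v → allJust λ col → searchReply fuel p v col (legal? p v col))

    searchReply : ℕ → (p : Partial n k) (v : Fin n) (col : Fin k) → Dec (Legal G p v col) →
                  Maybe (Legal G p v col → MoverWins G (update p v col))
    searchReply fuel p v col (no ¬l) = just (⊥-elim ∘ ¬l)
    searchReply fuel p v col (yes _) = map const (searchWin fuel (update p v col))

partialInjective⇒edgeDistinguishing : ∀ {n k} (G : Graph n) (c : Fin n → Fin k) →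
                           PartialInjective G (just ∘ c) → EdgeDistinguishing G k c
partialInjective⇒edgeDistinguishing G c inj u v x y uv xy =
  inj u v x y _ _ _ _ uv xy refl refl refl refl

IsLambda-unique : ∀ {n} {G : Graph n} {k m} → IsLambda G k → IsLambda G m → k ≡ m
IsLambda-unique {k = k} {m} (colouringK , minimalK) (colouringM , minimalM) with <-cmp k m
... | tri< k<m _ _ = ⊥-elim (minimalM k k<m colouringK)
... | tri≈ _ k≡m _ = k≡m
... | tri> _ _ m<k = ⊥-elim (minimalK m m<k colouringM)

adjPath? : ∀ n → Decidable (Adj (Path n))
adjPath? n i j = (toℕ j ℕ.≟ suc (toℕ i)) ⊎-dec (toℕ i ℕ.≟ suc (toℕ j))

colour0011 : Fin 4 → Fin 2
colour0011 zero       = zero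
colour0011 (suc zero) = zero
colour0011 _          = suc zero

colour0011-edgeDistinguishing : EdgeDistinguishing (Path 4) 2 colour0011
colour0011-edgeDistinguishing =
  partialInjective⇒edgeDistinguishing (Path 4) colour0011
    (from-yes (GameSearch.partialInjective? (Path 4) (adjPath? 4) (just ∘ colour0011)))

lambda-P4 : IsLambda (Path 4) 2
lambda-P4 = (colour0011 , colour0011-edgeDistinguishing) , noSmallerColouring
  where
  fin1-unique : (a b : Fin 1) → a ≡ b
  fin1-unique zero zero = refl

  noSmallerColouring : ∀ j → j ℕ.< 2 → ¬ ∃ λ (c : Fin 4 → Fin j) → EdgeDistinguishing (Path 4) j c
  noSmallerColouring zero       _ (c , _) = ¬Fin0 (c zero)
  noSmallerColouring (suc (suc j)) (s≤s (s≤s ()))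
  noSmallerColouring (suc zero) _ (c , ed)
    with ed zero (suc zero) (suc zero) (suc (suc zero)) (inj₁ refl) (inj₁ refl)
            (inj₁ (fin1-unique _ _ , fin1-unique _ _))
  ... | inj₁ (() , _)
  ... | inj₂ (() , _)

player1Wins-P4 : Player1Wins (Path 4) 2
player1Wins-P4 = from-just (GameSearch.searchWin {k = 2} (Path 4) (adjPath? 4) 4 empty)

theorem3p9 : (k : ℕ) → IsLambda (Path 4) k → Player1Wins (Path 4) k
theorem3p9 k isLambda = subst (Player1Wins (Path 4)) (IsLambda-unique lambda-P4 isLambda) player1Wins-P4
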